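{- Let $a$ and $b$ be positive integers such that $a\not\equiv 0 \pmod 4$, $b$ is squarefree, and $\mathcal{D}$ is squarefree, where $\mathcal{D}=a^2+4b$ if $a$ is odd and $\mathcal{D}=(a/2)^2+b$ if $a$ is even. Let $\alpha=(a+\sqrt{a^2+4b})/2$ and $\overline{\alpha}=(a-\sqrt{a^2+4b})/2$, and let $p\ge 3$ be a prime such that $\left(\frac{\mathcal{D}}{p}\right)=-1$. Then (1) $\operatorname{ord}_m(\alpha)=\operatorname{ord}_m(\overline{\alpha})=\pi(m)$ for $m\in\{p,p^2\}$, and (2) $\alpha^{p+1}\equiv -b\pmod p$.
   Context: Let $[U_n]$ be the Lucas sequence defined by $U_0=0$, $U_1=1$, $U_n=aU_{n-1}+bU_{n-2}$ for $n\ge 2$, and for an integer $m\ge 2$ with $\gcd(b,m)=1$ let $\pi(m)$ be the length of the period of $[U_n]$ modulo $m$. The numbers $\alpha,\overline{\alpha}$ are the roots of $x^2-ax-b$ and lie in the ring $\mathbb{Z}[\alpha]$; congruences modulo $m$ are in $\mathbb{Z}[\alpha]$ (i.e. modulo $m\mathbb{Z}[\alpha]$), and $\operatorname{ord}_m(\cdot)$ denotes multiplicative order modulo $m$ in $\mathbb{Z}[\alpha]/m\mathbb{Z}[\alpha]$. $\left(\frac{\cdot}{p}\right)$ is the Legendre symbol. -}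

module Defs where

open import Data.Nat as ℕ using (ℕ; zero; suc; _%_; _/_)
open import Data.Integer as ℤ using (ℤ; +_; _+_; _*_; _-_; -_)
open import Data.Integer.Divisibility using (_∣_)
open import Data.Product using (_×_; ∃)
open import Relation.Nullary using (¬_)
import Data.Nat.Divisibility as ℕD
open import Relation.Binary.PropositionalEquality using (_≡_)

_≡_[mod_] : ℤ → ℤ → ℕ → Set
x ≡ y [mod m ] = (+ m) ∣ (x - y)

-- The ring ℤ[α] = ℤ[x]/(x² - a x - b), elements written u + v α
-- (ℤ[α] is free over ℤ with basis 1, α).
record Zα : Set where
  constructor _+_α
  field
    re : ℤ
    im : ℤ
open Zα public

oneZα : Zα
oneZα = (+ 1) + (+ 0) α

-- multiplication, using α² = a α + b
mulZα : ℤ → ℤ → Zα → Zα → Zα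
mulZα a b (u₁ + v₁ α) (u₂ + v₂ α) =
  (u₁ * u₂ + b * (v₁ * v₂)) + (u₁ * v₂ + u₂ * v₁ + a * (v₁ * v₂)) α

powZα : ℤ → ℤ → Zα → ℕ → Zα
powZα a b x zero = oneZα
powZα a b x (suc n) = mulZα a b x (powZα a b x n)

-- α and its conjugate ᾱ = a - α
αZ : Zα
αZ = (+ 0) + (+ 1) α

αbarZ : ℤ → Zα
αbarZ a = a + (- (+ 1)) α

-- congruence modulo m ℤ[α] (componentwise, since m ℤ[α] = mℤ + mℤ α)
_≈_[modZα_] : Zα → Zα → ℕ → Set
x ≈ y [modZα m ] = (re x ≡ re y [mod m ]) × (im x ≡ im y [mod m ])

IsOrd : ℤ → ℤ → ℕ → Zα → ℕ → Set
IsOrd a b m x n =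
  (0 ℕ.< n) × (powZα a b x n ≈ oneZα [modZα m ]) ×
  (∀ k → 0 ℕ.< k → k ℕ.< n → ¬ (powZα a b x k ≈ oneZα [modZα m ]))

U : ℤ → ℤ → ℕ → ℤ
U a b zero = + 0
U a b (suc zero) = + 1
U a b (suc (suc n)) = a * U a b (suc n) + b * U a b n

HasPeriod : ℤ → ℤ → ℕ → ℕ → Set
HasPeriod a b m n = ∀ k → U a b (k ℕ.+ n) ≡ U a b k [mod m ]

IsPi : ℤ → ℤ → ℕ → ℕ → Set
IsPi a b m n =
  (0 ℕ.< n) × HasPeriod a b m n ×
  (∀ k → 0 ℕ.< k → k ℕ.< n → ¬ HasPeriod a b m k)

SquareFree : ℕ → Set
SquareFree n = ∀ d → (d ℕ.* d) ℕD.∣ n → d ≡ 1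

calD : ℕ → ℕ → ℕ
calD a b with a % 2
... | zero = (a / 2) ℕ.* (a / 2) ℕ.+ b
... | suc _ = a ℕ.* a ℕ.+ 4 ℕ.* b

-- Legendre symbol (D/p) = -1 for an odd prime p: D is a quadratic
-- non-residue mod p (no x with x² ≡ D; in particular p ∤ D).
LegendreMinusOne : ℤ → ℕ → Set
LegendreMinusOne D p = ¬ (∃ λ (x : ℤ) → (x * x) ≡ D [mod p ])

-- Since (𝒟/p) = -1 and a² + 4b is 𝒟 or 4𝒟, a² + 4b is a non-residue, so by Euler's criterion
-- (a² + 4b)^((p-1)/2) ≡ -1 (mod p); Wilson's theorem and Euler's criterion both come from
-- pairing each unit x with c·x⁻¹.  The element β = 2α - a satisfies β² = a² + 4b, hence
-- β^p ≡ -β, and the Frobenius identity (x + y)^p ≡ x^p + y^p in ℤ[α]/p applied to 2α = a + β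
-- gives 2α^p ≡ a - β = 2ᾱ.  So α^p ≡ ᾱ and α^(p+1) ≡ αᾱ = -b; in particular α has finite
-- order modulo p, and also modulo p² because z ≡ 1 (mod p) implies z^p ≡ 1 (mod p²).
-- Conjugation is a ring automorphism, so αⁿ ≡ 1 iff ᾱⁿ ≡ 1; and since Uₙ is the α-coordinate
-- of αⁿ while the other coordinate of αⁿ⁺¹ is b·Uₙ, n is a period of U iff αⁿ ≡ 1.  Hence the
-- least n with αⁿ ≡ 1 is ord(α) = ord(ᾱ) = π(m).

module Submission where

open import Defs
open import Algebra.Bundles using (CommutativeSemiring)
open import Algebra.Core using (Op₂)
open import Algebra.Definitions using (Congruent₂)
open import Algebra.Structures using (IsCommutativeSemiring)
open import Algebra.Structures.Biased using (IsCommutativeSemiringˡ)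
import Algebra.Properties.CommutativeSemiring.Binomial as Binomial
import Algebra.Properties.CommutativeSemiring.Exp as CExp
import Algebra.Properties.Monoid.Mult as Mult
import Algebra.Properties.Monoid.Sum as Sum
import Algebra.Properties.Semiring.Exp as Exp
open import Data.Bool using (Bool; true; false; if_then_else_)
open import Data.Fin as Fin using (Fin; toℕ)
import Data.Fin.Properties as Fin
open import Data.Integer as ℤ using (ℤ; +_)
import Data.Integer.Divisibility.Signed as Signed
import Data.Integer.Properties as ℤₚ
open import Data.Integer.Tactic.RingSolver using (solve-∀)
open import Data.List using (List; []; _∷_; length)
open import Data.List.Membership.Propositional using (_∈_)
open import Data.List.Relation.Binary.Permutation.Propositional
  using (_↭_; ↭-refl; ↭-prep; ↭-swap; ↭-trans; ↭-reflexive)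
open import Data.List.Relation.Binary.Permutation.Propositional.Properties using (↭-length)
open import Data.List.Relation.Unary.Any using (here; there)
open import Data.Nat as ℕ using (ℕ; zero; suc; _<_; _≤_; _∸_; _%_; _/_; _<?_; _≟_; z≤n; s≤s)
open import Data.Nat.Combinatorics using (_C_; nCn≡1; nC1≡n; nCk+nC[k+1]≡[n+1]C[k+1])
import Data.Nat.Divisibility as ℕ
open import Data.Nat.DivMod using (m%n≤m; m≡m%n+[m/n]*n; m%n<n)
open import Data.Nat.Induction using (<-rec)
open import Data.Nat.ListAction using (product)
open import Data.Nat.ListAction.Properties using (product-↭)
open import Data.Nat.Primality using (Prime; euclidsLemma; prime⇒nonZero)
import Data.Nat.Properties as ℕₚ
import Data.Nat.Tactic.RingSolver as ℕ
open import Data.Product using (∃; _×_; _,_; proj₁; proj₂; map₁)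
open import Data.Sum using (_⊎_; inj₁; inj₂; [_,_]′)
open import Data.Vec.Functional using (init; last; tail)
open import Function using (_∘_; _⇔_; mk⇔; Equivalence)
open import Level using (0ℓ)
open import Relation.Binary.Bundles using (Setoid)
open import Relation.Binary.Core using (Rel)
open import Relation.Binary.PropositionalEquality
  using (_≡_; _≢_; refl; sym; trans; cong; cong₂; subst; subst₂; isEquivalence; module ≡-Reasoning)
open import Relation.Binary.Structures using (IsEquivalence)
open import Relation.Nullary using (¬_; Dec; yes; no; contradiction)
open import Relation.Nullary.Decidable using (map′; _×-dec_)

module _ {A : Set} {_+ₐ_ _*ₐ_ : Op₂ A} {0ₐ 1ₐ : A}
         (isCS : IsCommutativeSemiring _≡_ _+ₐ_ _*ₐ_ 0ₐ 1ₐ) where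
  open IsCommutativeSemiring isCS

  quotientCommutativeSemiring : {_≈_ : Rel A 0ℓ} → IsEquivalence _≈_ →
    Congruent₂ _≈_ _+ₐ_ → Congruent₂ _≈_ _*ₐ_ → CommutativeSemiring 0ℓ 0ℓ
  quotientCommutativeSemiring {_≈_} isEq +-cong′ *-cong′ = record
    { Carrier = A ; _≈_ = _≈_ ; _+_ = _+ₐ_ ; _*_ = _*ₐ_ ; 0# = 0ₐ ; 1# = 1ₐ
    ; isCommutativeSemiring = IsCommutativeSemiringˡ.isCommutativeSemiring record
      { +-isCommutativeMonoid = record
        { isMonoid = record
          { isSemigroup = record
            { isMagma = record { isEquivalence = isEq ; ∙-cong = +-cong′ }
            ; assoc = λ x y z → ≈-reflexive (+-assoc x y z) }
          ; identity = (λ x → ≈-reflexive (+-identityˡ x)) ,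
                       (λ x → ≈-reflexive (+-identityʳ x)) }
        ; comm = λ x y → ≈-reflexive (+-comm x y) }
      ; *-isCommutativeMonoid = record
        { isMonoid = record
          { isSemigroup = record
            { isMagma = record { isEquivalence = isEq ; ∙-cong = *-cong′ }
            ; assoc = λ x y z → ≈-reflexive (*-assoc x y z) }
          ; identity = (λ x → ≈-reflexive (*-identityˡ x)) ,
                       (λ x → ≈-reflexive (*-identityʳ x)) }
        ; comm = λ x y → ≈-reflexive (*-comm x y) }
      ; distribʳ = λ x y z → ≈-reflexive (distribʳ x y z)
      ; zeroˡ = λ x → ≈-reflexive (zeroˡ x) }
    }
    where
      ≈-reflexive = IsEquivalence.reflexive isEq

least-positive : ∀ {P : ℕ → Set} → (∀ k → Dec (P k)) → ∀ {N} → 0 < N → P N →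
  ∃ λ n → 0 < n × P n × (∀ k → 0 < k → k < n → ¬ P k)
least-positive {P} P? {N} 0<N PN with search (suc N)
  where
    Q : ℕ → Set
    Q k = 0 < k × P k
    search : ∀ n → (∀ k → k < n → ¬ Q k) ⊎ ∃ λ n → Q n × (∀ k → k < n → ¬ Q k)
    search zero = inj₁ (λ _ ())
    search (suc n) with search n
    ... | inj₂ found = inj₂ found
    ... | inj₁ none with (0 <? n) ×-dec P? n
    ...   | yes Qn = inj₂ (n , Qn , none)
    ...   | no ¬Qn = inj₁ λ k k<1+n →
      [ none k , (λ { refl → ¬Qn }) ]′ (ℕₚ.m≤n⇒m<n∨m≡n (ℕₚ.≤-pred k<1+n))
... | inj₁ none = contradiction (0<N , PN) (none N (ℕₚ.n<1+n N))
... | inj₂ (n , (0<n , Pn) , none) = n , 0<n , Pn , λ k 0<k k<n Pk → none k k<n (0<k , Pk)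

-- The Frobenius identity

[1+k]*[1+n]C[1+k]≡[1+n]*nCk : ∀ n k → suc k ℕ.* (suc n C suc k) ≡ suc n ℕ.* (n C k)
[1+k]*[1+n]C[1+k]≡[1+n]*nCk zero zero = refl
[1+k]*[1+n]C[1+k]≡[1+n]*nCk zero (suc k) = ℕₚ.*-zeroʳ (suc (suc k))
[1+k]*[1+n]C[1+k]≡[1+n]*nCk (suc n) zero =
  trans (ℕₚ.*-identityˡ _) (trans (nC1≡n (suc (suc n))) (sym (ℕₚ.*-identityʳ _)))
[1+k]*[1+n]C[1+k]≡[1+n]*nCk (suc n) (suc k) = begin
  suc (suc k) ℕ.* (suc N C suc (suc k))
    ≡⟨ cong (suc (suc k) ℕ.*_) (nCk+nC[k+1]≡[n+1]C[k+1] N (suc k)) ⟨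
  suc (suc k) ℕ.* (N C suc k ℕ.+ N C suc (suc k))
    ≡⟨ expand (N C suc k) (N C suc (suc k)) k ⟩
  N C suc k ℕ.+ suc k ℕ.* (N C suc k) ℕ.+ suc (suc k) ℕ.* (N C suc (suc k))
    ≡⟨ cong₂ (λ u v → N C suc k ℕ.+ u ℕ.+ v) ([1+k]*[1+n]C[1+k]≡[1+n]*nCk n k)
                                              ([1+k]*[1+n]C[1+k]≡[1+n]*nCk n (suc k)) ⟩
  N C suc k ℕ.+ N ℕ.* (n C k) ℕ.+ N ℕ.* (n C suc k)
    ≡⟨ factor (N C suc k) (n C k) (n C suc k) N ⟩
  N C suc k ℕ.+ N ℕ.* (n C k ℕ.+ n C suc k)
    ≡⟨ cong (λ u → N C suc k ℕ.+ N ℕ.* u) (nCk+nC[k+1]≡[n+1]C[k+1] n k) ⟩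
  suc N ℕ.* (N C suc k) ∎
  where
    open ≡-Reasoning
    N = suc n
    expand : ∀ x y k →
      suc (suc k) ℕ.* (x ℕ.+ y) ≡ x ℕ.+ suc k ℕ.* x ℕ.+ suc (suc k) ℕ.* y
    expand = ℕ.solve-∀
    factor : ∀ c x y N → c ℕ.+ N ℕ.* x ℕ.+ N ℕ.* y ≡ c ℕ.+ N ℕ.* (x ℕ.+ y)
    factor = ℕ.solve-∀

prime∣pCk : ∀ {p k} → Prime p → 0 < k → k < p → p ℕ.∣ p C k
prime∣pCk {suc n} {suc k} p-prime _ k<p
  with euclidsLemma (suc k) (suc n C suc k) p-prime
         (ℕ.divides (n C k) (trans ([1+k]*[1+n]C[1+k]≡[1+n]*nCk n k) (ℕₚ.*-comm (suc n) _)))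
... | inj₁ p∣k = contradiction (ℕ.∣⇒≤ p∣k) (ℕₚ.<⇒≱ k<p)
... | inj₂ p∣pCk = p∣pCk

module Frobenius {c ℓ} (S : CommutativeSemiring c ℓ) where
  open CommutativeSemiring S hiding (sym) renaming (refl to ≈-refl; trans to ≈-trans)
  open Exp semiring using (_^_)
  open Mult +-monoid using (×-congʳ; ×-assocˡ) renaming (_×_ to _×ₙ_)
  open Sum +-monoid using (sum; sum-init-last; sum-cong-≋; sum-replicate-zero)
  open Binomial S using (theorem; binomialTerm)
  open import Relation.Binary.Reasoning.Setoid setoid

  CharacteristicDivides : ℕ → Set _
  CharacteristicDivides n = ∀ x → n ×ₙ x ≈ 0#

  ×-zeroʳ : ∀ n → n ×ₙ 0# ≈ 0#
  ×-zeroʳ zero = ≈-refl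
  ×-zeroʳ (suc n) = ≈-trans (+-identityˡ _) (×-zeroʳ n)

  ∣⇒×≈0 : ∀ {p n} → CharacteristicDivides p → ∀ x → p ℕ.∣ n → n ×ₙ x ≈ 0#
  ∣⇒×≈0 {p} char x (ℕ.divides d refl) = begin
    (d ℕ.* p) ×ₙ x ≈⟨ ×-assocˡ x d p ⟨
    d ×ₙ (p ×ₙ x)   ≈⟨ ×-congʳ d (char x) ⟩
    d ×ₙ 0#        ≈⟨ ×-zeroʳ d ⟩
    0#            ∎

  ^-distrib-+ : ∀ {p} → Prime p → CharacteristicDivides p →
                ∀ x y → (x + y) ^ p ≈ x ^ p + y ^ p
  ^-distrib-+ {suc q} p-prime char x y = begin
    (x + y) ^ p                                    ≈⟨ theorem p x y ⟩
    term Fin.zero + sum (tail term)                ≈⟨ +-congˡ (sum-init-last (tail term)) ⟩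
    term Fin.zero + (sum (init (tail term)) + last (tail term))
      ≈⟨ +-cong first (+-cong (≈-trans (sum-cong-≋ middle) (sum-replicate-zero q)) final) ⟩
    y ^ p + (0# + x ^ p)                           ≈⟨ +-congˡ (+-identityˡ _) ⟩
    y ^ p + x ^ p                                  ≈⟨ +-comm _ _ ⟩
    x ^ p + y ^ p                                  ∎
    where
      p = suc q
      term = binomialTerm x y p
      first : term Fin.zero ≈ y ^ p
      first = ≈-trans (+-identityʳ _) (*-identityˡ _)
      final : last (tail term) ≈ x ^ p
      final = begin
        (p C suc j) ×ₙ (x ^ suc j * y ^ (p ∸ suc j))
          ≈⟨ reflexive (cong (λ j → (p C suc j) ×ₙ (x ^ suc j * y ^ (p ∸ suc j))) (Fin.toℕ-fromℕ q)) ⟩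
        (p C p) ×ₙ (x ^ p * y ^ (p ∸ p))   ≈⟨ reflexive (cong (_×ₙ (x ^ p * y ^ (p ∸ p))) (nCn≡1 p)) ⟩
        x ^ p * y ^ (p ∸ p) + 0#           ≈⟨ +-identityʳ _ ⟩
        x ^ p * y ^ (p ∸ p)                ≈⟨ *-congˡ (reflexive (cong (y ^_) (ℕₚ.n∸n≡0 p))) ⟩
        x ^ p * 1#                         ≈⟨ *-identityʳ _ ⟩
        x ^ p                              ∎
        where j = toℕ (Fin.fromℕ q)
      middle : ∀ i → init (tail term) i ≈ 0#
      middle i = ∣⇒×≈0 char _ (subst (λ j → p ℕ.∣ p C suc j) (sym (Fin.toℕ-inject₁ i))
                   (prime∣pCk p-prime (s≤s z≤n) (s≤s (Fin.toℕ<n i))))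

-- Integers modulo m

module Modular (m : ℕ) where
  open import Data.Integer using (_+_; _*_; _-_; -_)
  open import Data.Integer.Divisibility using (_∣_)

  infix 4 _≋_ _≉_ _≋?_
  -- A record, so that x and y can be inferred from a proof.
  record _≋_ (x y : ℤ) : Set where
    constructor mk≋
    field ≋⇒≡[mod] : x ≡ y [mod m ]
  open _≋_ public

  _≉_ : ℤ → ℤ → Set
  x ≉ y = ¬ (x ≋ y)

  ∣⇒≋0 : ∀ {x} → + m ∣ x → x ≋ + 0
  ∣⇒≋0 {x} m∣x = mk≋ (subst (λ z → + m ∣ z) (sym (ℤₚ.+-identityʳ x)) m∣x)

  ≋0⇒∣ : ∀ {x} → x ≋ + 0 → + m ∣ x
  ≋0⇒∣ {x} (mk≋ m∣x) = subst (λ z → + m ∣ z) (ℤₚ.+-identityʳ x) m∣x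

  ≋⇒-≋0 : ∀ {x y} → x ≋ y → x - y ≋ + 0
  ≋⇒-≋0 (mk≋ m∣x-y) = ∣⇒≋0 m∣x-y

  -≋0⇒≋ : ∀ {x y} → x - y ≋ + 0 → x ≋ y
  -≋0⇒≋ x-y≋0 = mk≋ (≋0⇒∣ x-y≋0)

  private
    ∣-+ : ∀ {x y} → + m ∣ x → + m ∣ y → + m ∣ x + y
    ∣-+ {x} {y} m∣x m∣y =
      Signed.∣⇒∣ᵤ (Signed.∣m∣n⇒∣m+n (Signed.∣ᵤ⇒∣ {+ m} {x} m∣x) (Signed.∣ᵤ⇒∣ {+ m} {y} m∣y))

    ∣-neg : ∀ {x} → + m ∣ x → + m ∣ - x
    ∣-neg {x} m∣x = Signed.∣⇒∣ᵤ (Signed.∣m⇒∣-m (Signed.∣ᵤ⇒∣ {+ m} {x} m∣x))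

    ∣-* : ∀ k {x} → + m ∣ x → + m ∣ k * x
    ∣-* k {x} m∣x = Signed.∣⇒∣ᵤ (Signed.∣n⇒∣m*n k (Signed.∣ᵤ⇒∣ {+ m} {x} m∣x))

    ∣-subst : ∀ {x y} → x ≡ y → + m ∣ x → + m ∣ y
    ∣-subst = subst (λ z → + m ∣ z)

  ≋-refl : ∀ {x} → x ≋ x
  ≋-refl {x} = mk≋ (∣-subst (sym (ℤₚ.+-inverseʳ x)) (m ℕ.∣0))

  ≋-reflexive : ∀ {x y} → x ≡ y → x ≋ y
  ≋-reflexive refl = ≋-refl

  ≋-sym : ∀ {x y} → x ≋ y → y ≋ x
  ≋-sym {x} {y} (mk≋ d) = mk≋ (∣-subst (lemma x y) (∣-neg {x - y} d))
    where lemma : ∀ x y → - (x - y) ≡ y - x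
          lemma = solve-∀

  ≋-trans : ∀ {x y z} → x ≋ y → y ≋ z → x ≋ z
  ≋-trans {x} {y} {z} (mk≋ d) (mk≋ e) = mk≋ (∣-subst (lemma x y z) (∣-+ {x - y} {y - z} d e))
    where lemma : ∀ x y z → (x - y) + (y - z) ≡ x - z
          lemma = solve-∀

  ≋-isEquivalence : IsEquivalence _≋_
  ≋-isEquivalence = record { refl = ≋-refl ; sym = ≋-sym ; trans = ≋-trans }

  ≋-setoid : Setoid 0ℓ 0ℓ
  ≋-setoid = record { isEquivalence = ≋-isEquivalence }

  +-cong : ∀ {x x′ y y′} → x ≋ x′ → y ≋ y′ → x + y ≋ x′ + y′
  +-cong {x} {x′} {y} {y′} (mk≋ d) (mk≋ e) =
    mk≋ (∣-subst (lemma x x′ y y′) (∣-+ {x - x′} {y - y′} d e))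
    where lemma : ∀ x x′ y y′ → (x - x′) + (y - y′) ≡ (x + y) - (x′ + y′)
          lemma = solve-∀

  *-cong : ∀ {x x′ y y′} → x ≋ x′ → y ≋ y′ → x * y ≋ x′ * y′
  *-cong {x} {x′} {y} {y′} (mk≋ d) (mk≋ e) = mk≋ (∣-subst (lemma x x′ y y′)
    (∣-+ {y * (x - x′)} {x′ * (y - y′)} (∣-* y {x - x′} d) (∣-* x′ {y - y′} e)))
    where lemma : ∀ x x′ y y′ → y * (x - x′) + x′ * (y - y′) ≡ x * y - x′ * y′
          lemma = solve-∀

  neg-cong : ∀ {x x′} → x ≋ x′ → - x ≋ - x′
  neg-cong {x} {x′} (mk≋ d) = mk≋ (∣-subst (lemma x x′) (∣-neg {x - x′} d))
    where lemma : ∀ x x′ → - (x - x′) ≡ - x - - x′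
          lemma = solve-∀

  *-congˡ : ∀ {x y y′} → y ≋ y′ → x * y ≋ x * y′
  *-congˡ {x} = *-cong (≋-refl {x})

  *-congʳ : ∀ {x x′ y} → x ≋ x′ → x * y ≋ x′ * y
  *-congʳ {y = y} x≋x′ = *-cong x≋x′ (≋-refl {y})

  ℤ/m : CommutativeSemiring 0ℓ 0ℓ
  ℤ/m = quotientCommutativeSemiring ℤₚ.+-*-isCommutativeSemiring ≋-isEquivalence +-cong *-cong

  ≋⇒∣∸ : ∀ {u v} → v ≤ u → + u ≋ + v → m ℕ.∣ u ℕ.∸ v
  ≋⇒∣∸ {u} {v} v≤u (mk≋ m∣u-v) =
    subst (λ z → + m ∣ z) (trans (ℤₚ.m-n≡m⊖n u v) (ℤₚ.⊖-≥ v≤u)) m∣u-v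

  ∣∸⇒≋ : ∀ {u v} → v ≤ u → m ℕ.∣ u ℕ.∸ v → + u ≋ + v
  ∣∸⇒≋ {u} {v} v≤u m∣u∸v =
    mk≋ (subst (λ z → + m ∣ z) (sym (trans (ℤₚ.m-n≡m⊖n u v) (ℤₚ.⊖-≥ v≤u))) m∣u∸v)

  private
    ∣∸⇒≡ : ∀ {u v} → v ≤ u → u < m → m ℕ.∣ u ℕ.∸ v → v ≡ u
    ∣∸⇒≡ {u} {v} v≤u u<m m∣u∸v with u ℕ.∸ v in eq
    ... | zero = trans (sym (cong (ℕ._+ v) eq)) (ℕₚ.m∸n+n≡m v≤u)
    ... | suc _ = contradiction (ℕₚ.≤-trans (ℕ.∣⇒≤ m∣u∸v) (subst (_≤ u) eq (ℕₚ.m∸n≤m u v)))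
                                (ℕₚ.<⇒≱ u<m)

  <-≋-injective : ∀ {u v} → u < m → v < m → + u ≋ + v → u ≡ v
  <-≋-injective {u} {v} u<m v<m u≋v with ℕₚ.≤-total v u
  ... | inj₁ v≤u = sym (∣∸⇒≡ v≤u u<m (≋⇒∣∸ v≤u u≋v))
  ... | inj₂ u≤v = ∣∸⇒≡ u≤v v<m (≋⇒∣∸ u≤v (≋-sym u≋v))

  %-≋ : ∀ n .{{_ : ℕ.NonZero m}} → + (n ℕ.% m) ≋ + n
  %-≋ n = ≋-sym (∣∸⇒≋ (m%n≤m n m) (ℕ.divides (n / m) (begin
    n ∸ n % m                       ≡⟨ cong (_∸ n % m) (m≡m%n+[m/n]*n n m) ⟩
    n % m ℕ.+ n / m ℕ.* m ∸ n % m   ≡⟨ ℕₚ.m+n∸m≡n (n % m) _ ⟩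
    n / m ℕ.* m                     ∎)))
    where open ≡-Reasoning

  open Mult (CommutativeSemiring.+-monoid ℤ/m) using () renaming (_×_ to _×ₙ_)

  ×ₙ≡* : ∀ n x → n ×ₙ x ≡ + n * x
  ×ₙ≡* zero x = sym (ℤₚ.*-zeroˡ x)
  ×ₙ≡* (suc n) x = trans (cong (λ y → x + y) (×ₙ≡* n x)) (sym (ℤₚ.suc-* (+ n) x))

  m*≋0 : ∀ x → + m * x ≋ + 0
  m*≋0 x = ∣⇒≋0 (Signed.∣⇒∣ᵤ (Signed.∣m⇒∣m*n x (Signed.∣-refl {+ m})))

  ℤ/m-characteristic : Frobenius.CharacteristicDivides ℤ/m m
  ℤ/m-characteristic x = subst (_≋ + 0) (sym (×ₙ≡* m x)) (m*≋0 x)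

  _≋?_ : ∀ x y → Dec (x ≋ y)
  x ≋? y = map′ mk≋ ≋⇒≡[mod] (m ℕ.∣? ℤ.∣ x - y ∣)

elementsBelow : (ℕ → Bool) → ℕ → List ℕ
elementsBelow S zero = []
elementsBelow S (suc n) = if S n then n ∷ elementsBelow S n else elementsBelow S n

remove : (ℕ → Bool) → ℕ → ℕ → Bool
remove S x k with k ≟ x
... | yes _ = false
... | no _ = S k

remove-≢ : ∀ S {x k} → k ≢ x → remove S x k ≡ S k
remove-≢ S {x} {k} k≢x with k ≟ x
... | yes k≡x = contradiction k≡x k≢x
... | no _ = refl

remove-true : ∀ S {x k} → remove S x k ≡ true → k ≢ x × S k ≡ true
remove-true S {x} {k} h with k ≟ x
... | no k≢x = k≢x , h

elementsBelow-cong : ∀ {S T} n → (∀ {k} → k < n → S k ≡ T k) →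
  elementsBelow S n ≡ elementsBelow T n
elementsBelow-cong zero S≗T = refl
elementsBelow-cong (suc n) S≗T
  rewrite S≗T (ℕₚ.n<1+n n) | elementsBelow-cong n (λ k<n → S≗T (ℕₚ.m<n⇒m<1+n k<n)) = refl

∈-elementsBelow⁻ : ∀ {S x} n → x ∈ elementsBelow S n → x < n × S x ≡ true
∈-elementsBelow⁻ {S} (suc n) x∈ with S n in Sn
∈-elementsBelow⁻ {S} (suc n) (here refl) | true = ℕₚ.n<1+n n , Sn
∈-elementsBelow⁻ {S} (suc n) (there x∈) | true =
  map₁ ℕₚ.m<n⇒m<1+n (∈-elementsBelow⁻ n x∈)
∈-elementsBelow⁻ {S} (suc n) x∈ | false = map₁ ℕₚ.m<n⇒m<1+n (∈-elementsBelow⁻ n x∈)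

elementsBelow-remove : ∀ {S x} n → x < n → S x ≡ true →
  elementsBelow S n ↭ x ∷ elementsBelow (remove S x) n
elementsBelow-remove {S} {x} (suc n) x<1+n Sx with n ≟ x
... | yes refl rewrite Sx =
  ↭-reflexive (cong (n ∷_) (elementsBelow-cong n (λ k<n → sym (remove-≢ S (ℕₚ.<⇒≢ k<n)))))
... | no n≢x with S n
...   | false = elementsBelow-remove n x<n Sx
  where x<n = ℕₚ.≤∧≢⇒< (ℕₚ.≤-pred x<1+n) (λ x≡n → n≢x (sym x≡n))
...   | true = ↭-trans (↭-prep n (elementsBelow-remove n x<n Sx)) (↭-swap n x ↭-refl)
  where x<n = ℕₚ.≤∧≢⇒< (ℕₚ.≤-pred x<1+n) (λ x≡n → n≢x (sym x≡n))

elementsBelow-remove₂ : ∀ {S x y} n → x < n → y < n → S x ≡ true → S y ≡ true → y ≢ x →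
  elementsBelow S n ↭ x ∷ y ∷ elementsBelow (remove (remove S x) y) n
elementsBelow-remove₂ {S} n x<n y<n Sx Sy y≢x = ↭-trans (elementsBelow-remove n x<n Sx)
  (↭-prep _ (elementsBelow-remove n y<n (trans (remove-≢ S y≢x) Sy)))

module Pairing (m n c : ℕ) (ι : ℕ → ℕ) where
  open import Data.Integer using (_^_)
  open Modular m

  PairsOff : (ℕ → Bool) → Set
  PairsOff S = ∀ {x} → x < n → S x ≡ true →
    ι x < n × S (ι x) ≡ true × ι x ≢ x × ι (ι x) ≡ x × + x ℤ.* + ι x ≋ + c

  private
    remove-pair : ∀ {S x} → x < n → S x ≡ true → PairsOff S →
                  PairsOff (remove (remove S x) (ι x))
    remove-pair {S} {x} x<n Sx pairs {z} z<n Sz′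
      with remove-true (remove S x) Sz′
    ... | z≢ιx , S₁z with remove-true S S₁z
    ...   | z≢x , Sz with pairs z<n Sz | pairs x<n Sx
    ...     | ιz<n , Sιz , ιz≢z , ιιz≡z , z*ιz≋c | _ , _ , _ , ιιx≡x , _ =
      ιz<n , trans (remove-≢ _ ιz≢ιx) (trans (remove-≢ S ιz≢x) Sιz) ,
      ιz≢z , ιιz≡z , z*ιz≋c
      where
        ιz≢x : ι z ≢ x
        ιz≢x ιz≡x = z≢ιx (trans (sym ιιz≡z) (cong ι ιz≡x))
        ιz≢ιx : ι z ≢ ι x
        ιz≢ιx ιz≡ιx = z≢x (trans (sym ιιz≡z) (trans (cong ι ιz≡ιx) ιιx≡x))

  PairedProduct : (ℕ → Bool) → Set
  PairedProduct S =
    ∃ λ k → length (elementsBelow S n) ≡ k ℕ.+ k × + product (elementsBelow S n) ≋ (+ c) ^ k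

  pairing : ∀ S → PairsOff S → PairedProduct S
  pairing S = <-rec Motive step _ S refl
    where
      Motive : ℕ → Set
      Motive ℓ = ∀ S → length (elementsBelow S n) ≡ ℓ → PairsOff S → PairedProduct S

      step : ∀ ℓ → (∀ {ℓ′} → ℓ′ < ℓ → Motive ℓ′) → Motive ℓ
      step _ rec S refl pairs with elementsBelow S n in eq
      ... | [] = 0 , refl , ≋-refl
      ... | x ∷ xs with ∈-elementsBelow⁻ n (subst (x ∈_) (sym eq) (here refl))
      ...   | x<n , Sx with pairs x<n Sx
      ...     | ιx<n , Sιx , ιx≢x , _ , x*ιx≋c =
        let S₂ = remove (remove S x) (ι x)
            perm : x ∷ xs ↭ x ∷ ι x ∷ elementsBelow S₂ n
            perm = subst (λ L → L ↭ x ∷ ι x ∷ elementsBelow S₂ n) eq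
                     (elementsBelow-remove₂ n x<n ιx<n Sx Sιx ιx≢x)
            ℓ₂<ℓ = subst (length (elementsBelow S₂ n) <_) (sym (↭-length perm))
                     (ℕₚ.m<n⇒m<1+n (ℕₚ.n<1+n _))
            (k , len≡ , prod≋) = rec ℓ₂<ℓ S₂ refl (remove-pair x<n Sx pairs)
            P₂ = product (elementsBelow S₂ n)
        in suc k ,
           trans (trans (↭-length perm) (cong (suc ∘ suc) len≡)) (cong suc (sym (ℕₚ.+-suc k k))) ,
           (begin
             + product (x ∷ xs)             ≡⟨ cong +_ (product-↭ perm) ⟩
             + (x ℕ.* (ι x ℕ.* P₂))         ≡⟨ trans (ℤₚ.pos-* x _) (cong (+ x ℤ.*_) (ℤₚ.pos-* (ι x) P₂)) ⟩
             + x ℤ.* (+ ι x ℤ.* + P₂)       ≡⟨ ℤₚ.*-assoc (+ x) (+ ι x) (+ P₂) ⟨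
             + x ℤ.* + ι x ℤ.* + P₂         ≈⟨ *-cong x*ιx≋c prod≋ ⟩
             + c ℤ.* (+ c) ^ k              ∎)
        where open import Relation.Binary.Reasoning.Setoid ≋-setoid

-- Fermat, Wilson and Euler

pos-^ : ∀ m n → + (m ℕ.^ n) ≡ (+ m) ℤ.^ n
pos-^ m zero = refl
pos-^ m (suc n) = trans (ℤₚ.pos-* m (m ℕ.^ n)) (cong (+ m ℤ.*_) (pos-^ m n))

module PrimeModulus {p} (p-prime : Prime p) where
  open import Data.Integer using (_+_; _*_; _-_; -_; _^_)
  open Modular p public
  open Prime p-prime using (nontrivial)
  open Exp (CommutativeSemiring.semiring ℤ/m) using () renaming (_^_ to _^ₘ_)
  open import Relation.Binary.Reasoning.Setoid ≋-setoid

  instance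
    p≢0 : ℕ.NonZero p
    p≢0 = prime⇒nonZero p-prime

  1<p : 1 < p
  1<p = ℕ.nonTrivial⇒n>1 p

  1≤p : 1 ≤ p
  1≤p = ℕₚ.<⇒≤ 1<p

  p≡2+[p∸2] : p ≡ suc (suc (p ∸ 2))
  p≡2+[p∸2] = sym (ℕₚ.m+[n∸m]≡n 1<p)

  ^ₘ≡^ : ∀ x n → x ^ₘ n ≡ x ^ n
  ^ₘ≡^ x zero = refl
  ^ₘ≡^ x (suc n) = cong (x *_) (^ₘ≡^ x n)

  fermat : ∀ n → (+ n) ^ p ≋ + n
  fermat zero = ≋-reflexive (subst (λ k → (+ 0) ^ k ≡ + 0) (sym p≡2+[p∸2]) refl)
  fermat (suc n) = begin
    (+ 1 + + n) ^ p            ≡⟨ ^ₘ≡^ (+ 1 + + n) p ⟨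
    (+ 1 + + n) ^ₘ p           ≈⟨ frobenius (+ 1) (+ n) ⟩
    (+ 1) ^ₘ p + (+ n) ^ₘ p    ≡⟨ cong₂ _+_ (trans (^ₘ≡^ (+ 1) p) (ℤₚ.^-zeroˡ p)) (^ₘ≡^ (+ n) p) ⟩
    + 1 + (+ n) ^ p            ≈⟨ +-cong (≋-refl {+ 1}) (fermat n) ⟩
    + 1 + + n                  ∎
    where frobenius = Frobenius.^-distrib-+ ℤ/m p-prime ℤ/m-characteristic

  *-≋0 : ∀ x y → x * y ≋ + 0 → x ≋ + 0 ⊎ y ≋ + 0
  *-≋0 x y xy≋0
    with euclidsLemma ℤ.∣ x ∣ ℤ.∣ y ∣ p-prime (subst (p ℕ.∣_) (ℤₚ.abs-* x y) (≋0⇒∣ xy≋0))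
  ... | inj₁ p∣x = inj₁ (∣⇒≋0 p∣x)
  ... | inj₂ p∣y = inj₂ (∣⇒≋0 p∣y)

  *-cancelˡ-≋ : ∀ x {y z} → x ≉ + 0 → x * y ≋ x * z → y ≋ z
  *-cancelˡ-≋ x {y} {z} x≉0 xy≋xz
    with *-≋0 x (y - z) (subst (_≋ + 0) (distrib x y z) (≋⇒-≋0 xy≋xz))
    where distrib : ∀ x y z → x * y - x * z ≡ x * (y - z)
          distrib = solve-∀
  ... | inj₁ x≋0 = contradiction x≋0 x≉0
  ... | inj₂ y-z≋0 = -≋0⇒≋ y-z≋0

  <p⇒≉0 : ∀ {x} → 0 < x → x < p → + x ≉ + 0
  <p⇒≉0 {suc x} _ x<p x≋0 with <-≋-injective x<p (ℕₚ.≤-<-trans z≤n x<p) x≋0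
  ... | ()

  fermat-unit : ∀ n → + n ≉ + 0 → (+ n) ^ (p ∸ 1) ≋ + 1
  fermat-unit n n≉0 = *-cancelˡ-≋ (+ n) n≉0 (begin
    + n * (+ n) ^ (p ∸ 1)  ≡⟨ cong ((+ n) ^_) (ℕₚ.m+[n∸m]≡n 1≤p) ⟩
    (+ n) ^ p              ≈⟨ fermat n ⟩
    + n                    ≡⟨ ℤₚ.*-identityʳ (+ n) ⟨
    + n * + 1              ∎)

  square≋1 : ∀ x → x * x ≋ + 1 → x ≋ + 1 ⊎ x ≋ - + 1
  square≋1 x x²≋1
    with *-≋0 (x - + 1) (x + + 1) (subst (_≋ + 0) (factor x) (≋⇒-≋0 x²≋1))
    where factor : ∀ x → x * x - + 1 ≡ (x - + 1) * (x + + 1)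
          factor = solve-∀
  ... | inj₁ x-1≋0 = inj₁ (-≋0⇒≋ x-1≋0)
  ... | inj₂ x+1≋0 = inj₂ (-≋0⇒≋ x+1≋0)

  module Division (c : ℕ) (c≉0 : + c ≉ + 0) where

    -- c · x⁻¹, with x⁻¹ = x^(p-2) by Fermat.
    divide : ℕ → ℕ
    divide x = (c ℕ.* x ℕ.^ (p ∸ 2)) % p

    divide<p : ∀ x → divide x < p
    divide<p x = m%n<n _ p

    *-divide : ∀ {x} → + x ≉ + 0 → + x * + divide x ≋ + c
    *-divide {x} x≉0 = begin
      + x * + divide x                       ≈⟨ *-congˡ {+ x} (%-≋ _) ⟩
      + x * + (c ℕ.* x ℕ.^ (p ∸ 2))          ≡⟨ cong (+ x *_) (trans (ℤₚ.pos-* c _) (cong (+ c *_) (pos-^ x (p ∸ 2)))) ⟩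
      + x * (+ c * (+ x) ^ (p ∸ 2))          ≡⟨ swap (+ x) (+ c) _ ⟩
      + c * (+ x) ^ suc (p ∸ 2)              ≡⟨ cong (λ k → + c * (+ x) ^ (k ∸ 1)) p≡2+[p∸2] ⟨
      + c * (+ x) ^ (p ∸ 1)                  ≈⟨ *-congˡ {+ c} (fermat-unit x x≉0) ⟩
      + c * + 1                              ≡⟨ ℤₚ.*-identityʳ (+ c) ⟩
      + c                                    ∎
      where swap : ∀ a b d → a * (b * d) ≡ b * (a * d)
            swap = solve-∀

    divide-≉0 : ∀ {x} → + x ≉ + 0 → + divide x ≉ + 0
    divide-≉0 {x} x≉0 q≋0 = c≉0 (begin
      + c                ≈⟨ *-divide x≉0 ⟨
      + x * + divide x   ≈⟨ *-congˡ {+ x} q≋0 ⟩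
      + x * + 0          ≡⟨ ℤₚ.*-zeroʳ (+ x) ⟩
      + 0                ∎)

    divide-involutive : ∀ {x} → x < p → + x ≉ + 0 → divide (divide x) ≡ x
    divide-involutive {x} x<p x≉0 = <-≋-injective (divide<p _) x<p
      (*-cancelˡ-≋ (+ divide x) (divide-≉0 x≉0) (begin
        + divide x * + divide (divide x)   ≈⟨ *-divide (divide-≉0 x≉0) ⟩
        + c                                ≈⟨ *-divide x≉0 ⟨
        + x * + divide x                   ≡⟨ ℤₚ.*-comm (+ x) _ ⟩
        + divide x * + x                   ∎))

  units : ℕ → Bool
  units = remove (λ _ → true) 0

  units⇒≉0 : ∀ {x} → x < p → units x ≡ true → + x ≉ + 0
  units⇒≉0 {x} x<p ux with remove-true (λ _ → true) {0} {x} ux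
  ... | x≢0 , _ = <p⇒≉0 (ℕₚ.n≢0⇒n>0 x≢0) x<p

  ≉0⇒units : ∀ {x} → + x ≉ + 0 → units x ≡ true
  ≉0⇒units {x} x≉0 = remove-≢ (λ _ → true) {0} {x} (λ { refl → x≉0 ≋-refl })

  length-units : p ≡ suc (length (elementsBelow units p))
  length-units = trans (sym (length-all p))
    (↭-length (elementsBelow-remove p (ℕₚ.≤-<-trans z≤n 1<p) refl))
    where
      length-all : ∀ n → length (elementsBelow (λ _ → true) n) ≡ n
      length-all zero = refl
      length-all (suc n) = cong suc (length-all n)

  p∸1<p : p ∸ 1 < p
  p∸1<p = ℕₚ.∸-monoʳ-< (s≤s z≤n) 1≤p

  p∸1≋-1 : + (p ∸ 1) ≋ - + 1
  p∸1≋-1 = -≋0⇒≋ (subst (_≋ + 0) (cong +_ (sym (ℕₚ.m∸n+n≡m 1≤p))) (∣⇒≋0 (ℕ.∣-refl {p})))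

  ≋±1⇒≡ : ∀ {x} → x < p → + x ≋ + 1 ⊎ + x ≋ - + 1 → x ≡ 1 ⊎ x ≡ p ∸ 1
  ≋±1⇒≡ x<p (inj₁ x≋1) = inj₁ (<-≋-injective x<p 1<p x≋1)
  ≋±1⇒≡ x<p (inj₂ x≋-1) = inj₂ (<-≋-injective x<p p∸1<p (≋-trans x≋-1 (≋-sym p∸1≋-1)))

  private
    module Inverse = Division 1 (<p⇒≉0 (s≤s z≤n) 1<p)

  unitsExcept±1 : ℕ → Bool
  unitsExcept±1 = remove (remove units 1) (p ∸ 1)

  inverse-pairsOff : Pairing.PairsOff p p 1 Inverse.divide unitsExcept±1
  inverse-pairsOff {x} x<p mx with remove-true (remove units 1) {p ∸ 1} {x} mx
  ... | x≢p∸1 , m₁x with remove-true units {1} {x} m₁x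
  ...   | x≢1 , ux = divide<p x , y∈ , y≢x , divide-involutive x<p x≉0 , x*y≋1
    where
      open Inverse
      x≉0 = units⇒≉0 x<p ux
      y = divide x
      x*y≋1 : + x * + y ≋ + 1
      x*y≋1 = *-divide x≉0
      x≉±1 : ¬ (+ x ≋ + 1 ⊎ + x ≋ - + 1)
      x≉±1 x≋±1 with ≋±1⇒≡ x<p x≋±1
      ... | inj₁ x≡1 = x≢1 x≡1
      ... | inj₂ x≡p∸1 = x≢p∸1 x≡p∸1
      y≢1 : y ≢ 1
      y≢1 y≡1 = x≉±1 (inj₁ (≋-trans (≋-reflexive (sym (ℤₚ.*-identityʳ (+ x))))
                                    (subst (λ w → + x * + w ≋ + 1) y≡1 x*y≋1)))
      y≢p∸1 : y ≢ p ∸ 1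
      y≢p∸1 y≡p∸1 = x≉±1 (inj₂ (≋-trans (≋-reflexive (negate (+ x)))
        (neg-cong (≋-trans (*-congˡ {+ x} (≋-sym p∸1≋-1))
                           (subst (λ w → + x * + w ≋ + 1) y≡p∸1 x*y≋1)))))
        where negate : ∀ x → x ≡ - (x * - + 1)
              negate = solve-∀
      y≢x : y ≢ x
      y≢x y≡x = x≉±1 (square≋1 (+ x) (subst (λ w → + x * + w ≋ + 1) y≡x x*y≋1))
      y∈ : unitsExcept±1 y ≡ true
      y∈ = trans (remove-≢ (remove units 1) {p ∸ 1} {y} y≢p∸1)
             (trans (remove-≢ units {1} {y} y≢1) (≉0⇒units (divide-≉0 x≉0)))

  wilson : 2 < p → + product (elementsBelow units p) ≋ - + 1
  wilson 2<p = begin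
    + product (elementsBelow units p)        ≡⟨ cong +_ (product-↭ perm) ⟩
    + (1 ℕ.* ((p ∸ 1) ℕ.* P))                ≡⟨ trans (ℤₚ.pos-* 1 _) (cong (+ 1 *_) (ℤₚ.pos-* (p ∸ 1) P)) ⟩
    + 1 * (+ (p ∸ 1) * + P)                  ≈⟨ *-congˡ {+ 1} (*-cong p∸1≋-1 ∏≋1) ⟩
    + 1 * (- + 1 * (+ 1) ^ k)                ≡⟨ cong (λ w → + 1 * (- + 1 * w)) (ℤₚ.^-zeroˡ k) ⟩
    - + 1                                    ∎
    where
      P = product (elementsBelow unitsExcept±1 p)
      paired = Pairing.pairing p p 1 Inverse.divide unitsExcept±1 inverse-pairsOff
      k = proj₁ paired
      ∏≋1 = proj₂ (proj₂ paired)
      p∸1≢1 : p ∸ 1 ≢ 1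
      p∸1≢1 p∸1≡1 = ℕₚ.<-irrefl (sym (trans (sym (ℕₚ.m∸n+n≡m 1≤p)) (cong (ℕ._+ 1) p∸1≡1))) 2<p
      perm = elementsBelow-remove₂ p 1<p p∸1<p refl
               (≉0⇒units (<p⇒≉0 (ℕₚ.m<n⇒0<n∸m 1<p) p∸1<p)) p∸1≢1

  euler-criterion : 2 < p → ∀ D → LegendreMinusOne (+ D) p →
    ∃ λ k → p ≡ suc (k ℕ.+ k) × (+ D) ^ k ≋ - + 1
  euler-criterion 2<p D nonresidue =
    k , trans length-units (cong suc length≡k+k) , ≋-trans (≋-sym ∏≋D^k) (wilson 2<p)
    where
      D≉0 : + D ≉ + 0
      D≉0 D≋0 = nonresidue (+ 0 , ≋⇒≡[mod] (≋-sym D≋0))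
      open Division D D≉0
      pairs : Pairing.PairsOff p p D divide units
      pairs {x} x<p ux =
        divide<p x , ≉0⇒units (divide-≉0 x≉0) , y≢x , divide-involutive x<p x≉0 , *-divide x≉0
        where
          x≉0 = units⇒≉0 x<p ux
          y≢x : divide x ≢ x
          y≢x y≡x = nonresidue (+ x , ≋⇒≡[mod] (subst (λ w → + x * + w ≋ + D) y≡x (*-divide x≉0)))
      paired = Pairing.pairing p p D divide units pairs
      k = proj₁ paired
      length≡k+k = proj₁ (proj₂ paired)
      ∏≋D^k = proj₂ (proj₂ paired)

  nonresidue-*-square : ∀ {D} c → + c ≉ + 0 →
    LegendreMinusOne D p → LegendreMinusOne (+ c * + c * D) p
  nonresidue-*-square {D} c c≉0 nonresidue (x , x²≡c²D) = nonresidue (x * + i , ≋⇒≡[mod] (begin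
    (x * + i) * (x * + i)          ≡⟨ regroup x (+ i) ⟩
    (x * x) * (+ i * + i)          ≈⟨ *-congʳ {y = + i * + i} (mk≋ {x * x} x²≡c²D) ⟩
    (+ c * + c * D) * (+ i * + i)  ≡⟨ regroup′ (+ c) (+ i) D ⟩
    (+ c * + i) * (+ c * + i) * D  ≈⟨ *-congʳ {y = D} (*-cong c*i≋1 c*i≋1) ⟩
    + 1 * + 1 * D                  ≡⟨ ℤₚ.*-identityˡ D ⟩
    D                              ∎))
    where
      i = Inverse.divide c
      c*i≋1 : + c * + i ≋ + 1
      c*i≋1 = Inverse.*-divide c≉0
      regroup : ∀ x i → (x * i) * (x * i) ≡ (x * x) * (i * i)
      regroup = solve-∀
      regroup′ : ∀ c i D → (c * c * D) * (i * i) ≡ (c * i) * (c * i) * D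
      regroup′ = solve-∀

-- The ring ℤ[α] modulo m

module QuadraticRing (A B : ℤ) where
  open import Data.Integer using (_+_; _*_; _-_; -_)
  open import Data.Integer.Divisibility using (_∣_)

  Zα-≡ : ∀ {x y : Zα} → re x ≡ re y → im x ≡ im y → x ≡ y
  Zα-≡ {_ + _ α} {_ + _ α} refl refl = refl

  addZα : Zα → Zα → Zα
  addZα (u₁ + v₁ α) (u₂ + v₂ α) = (u₁ + u₂) + (v₁ + v₂) α

  zeroZα : Zα
  zeroZα = (+ 0) + (+ 0) α

  infixl 7 _·_
  _·_ : Zα → Zα → Zα
  _·_ = mulZα A B

  +α-assoc : ∀ x y z → addZα (addZα x y) z ≡ addZα x (addZα y z)
  +α-assoc (a + b α) (c + d α) (e + f α) = Zα-≡ (lemma a c e) (lemma b d f)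
    where lemma : ∀ a c e → (a + c) + e ≡ a + (c + e)
          lemma = solve-∀

  +α-comm : ∀ x y → addZα x y ≡ addZα y x
  +α-comm (a + b α) (c + d α) = Zα-≡ (ℤₚ.+-comm a c) (ℤₚ.+-comm b d)

  +α-identityˡ : ∀ x → addZα zeroZα x ≡ x
  +α-identityˡ (a + b α) = Zα-≡ (ℤₚ.+-identityˡ a) (ℤₚ.+-identityˡ b)

  ·-assoc : ∀ x y z → (x · y) · z ≡ x · (y · z)
  ·-assoc (a + b α) (c + d α) (e + f α) =
    Zα-≡ (lemma₁ A B a b c d e f) (lemma₂ A B a b c d e f)
    where
      lemma₁ : ∀ A B a b c d e f →
        (a * c + B * (b * d)) * e + B * ((a * d + c * b + A * (b * d)) * f)
        ≡ a * (c * e + B * (d * f)) + B * (b * (c * f + e * d + A * (d * f)))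
      lemma₁ = solve-∀
      lemma₂ : ∀ A B a b c d e f →
        (a * c + B * (b * d)) * f + e * (a * d + c * b + A * (b * d))
          + A * ((a * d + c * b + A * (b * d)) * f)
        ≡ a * (c * f + e * d + A * (d * f)) + (c * e + B * (d * f)) * b
          + A * (b * (c * f + e * d + A * (d * f)))
      lemma₂ = solve-∀

  ·-comm : ∀ x y → x · y ≡ y · x
  ·-comm (a + b α) (c + d α) = Zα-≡ (lemma₁ B a b c d) (lemma₂ A a b c d)
    where
      lemma₁ : ∀ B a b c d → a * c + B * (b * d) ≡ c * a + B * (d * b)
      lemma₁ = solve-∀
      lemma₂ : ∀ A a b c d → a * d + c * b + A * (b * d) ≡ c * b + a * d + A * (d * b)
      lemma₂ = solve-∀

  ·-identityˡ : ∀ x → oneZα · x ≡ x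
  ·-identityˡ (a + b α) = Zα-≡ (lemma₁ B a b) (lemma₂ A a b)
    where
      lemma₁ : ∀ B a b → + 1 * a + B * (+ 0 * b) ≡ a
      lemma₁ = solve-∀
      lemma₂ : ∀ A a b → + 1 * b + a * + 0 + A * (+ 0 * b) ≡ b
      lemma₂ = solve-∀

  ·-distribʳ : ∀ x y z → addZα y z · x ≡ addZα (y · x) (z · x)
  ·-distribʳ (a + b α) (c + d α) (e + f α) =
    Zα-≡ (lemma₁ B a b c d e f) (lemma₂ A a b c d e f)
    where
      lemma₁ : ∀ B a b c d e f →
        (c + e) * a + B * ((d + f) * b) ≡ (c * a + B * (d * b)) + (e * a + B * (f * b))
      lemma₁ = solve-∀
      lemma₂ : ∀ A a b c d e f →
        (c + e) * b + a * (d + f) + A * ((d + f) * b)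
        ≡ (c * b + a * d + A * (d * b)) + (e * b + a * f + A * (f * b))
      lemma₂ = solve-∀

  ·-zeroˡ : ∀ x → zeroZα · x ≡ zeroZα
  ·-zeroˡ (a + b α) = Zα-≡ (lemma₁ B a b) (lemma₂ A a b)
    where
      lemma₁ : ∀ B a b → + 0 * a + B * (+ 0 * b) ≡ + 0
      lemma₁ = solve-∀
      lemma₂ : ∀ A a b → + 0 * b + a * + 0 + A * (+ 0 * b) ≡ + 0
      lemma₂ = solve-∀

  isCommutativeSemiring : IsCommutativeSemiring _≡_ addZα _·_ zeroZα oneZα
  isCommutativeSemiring = IsCommutativeSemiringˡ.isCommutativeSemiring record
    { +-isCommutativeMonoid = record
      { isMonoid = record
        { isSemigroup = record
          { isMagma = record { isEquivalence = isEquivalence ; ∙-cong = cong₂ addZα }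
          ; assoc = +α-assoc }
        ; identity = +α-identityˡ , λ x → trans (+α-comm x zeroZα) (+α-identityˡ x) }
      ; comm = +α-comm }
    ; *-isCommutativeMonoid = record
      { isMonoid = record
        { isSemigroup = record
          { isMagma = record { isEquivalence = isEquivalence ; ∙-cong = cong₂ _·_ }
          ; assoc = ·-assoc }
        ; identity = ·-identityˡ , λ x → trans (·-comm x oneZα) (·-identityˡ x) }
      ; comm = ·-comm }
    ; distribʳ = ·-distribʳ
    ; zeroˡ = ·-zeroˡ
    }

  open IsCommutativeSemiring isCommutativeSemiring public using ()
    renaming (*-identityʳ to ·-identityʳ)

  ι : ℤ → Zα
  ι x = x + (+ 0) α

  ι-· : ∀ x y → ι x · ι y ≡ ι (x * y)
  ι-· x y = Zα-≡ (lemma₁ B x y) (lemma₂ A x y)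
    where
      lemma₁ : ∀ B x y → x * y + B * (+ 0 * + 0) ≡ x * y
      lemma₁ = solve-∀
      lemma₂ : ∀ A x y → x * + 0 + y * + 0 + A * (+ 0 * + 0) ≡ + 0
      lemma₂ = solve-∀

  conj : Zα → Zα
  conj (u + v α) = (u + A * v) + (- v) α

  conj-· : ∀ x y → conj (x · y) ≡ conj x · conj y
  conj-· (a + b α) (c + d α) = Zα-≡ (lemma₁ A B a b c d) (lemma₂ A B a b c d)
    where
      lemma₁ : ∀ A B a b c d → a * c + B * (b * d) + A * (a * d + c * b + A * (b * d))
               ≡ (a + A * b) * (c + A * d) + B * (- b * - d)
      lemma₁ = solve-∀
      lemma₂ : ∀ A B a b c d → - (a * d + c * b + A * (b * d))
               ≡ (a + A * b) * - d + (c + A * d) * - b + A * (- b * - d)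
      lemma₂ = solve-∀

  conj-α^ : ∀ n → conj (powZα A B αZ n) ≡ powZα A B (αbarZ A) n
  conj-α^ zero = Zα-≡ (cong (λ w → + 1 + w) (ℤₚ.*-zeroʳ A)) refl
  conj-α^ (suc n) = trans (conj-· αZ (powZα A B αZ n)) (cong₂ _·_ conj-α (conj-α^ n))
    where conj-α : conj αZ ≡ αbarZ A
          conj-α = Zα-≡ (trans (ℤₚ.+-identityˡ (A * + 1)) (ℤₚ.*-identityʳ A)) refl

  re-α· : ∀ z → re (αZ · z) ≡ B * im z
  re-α· (u + v α) = lemma A B u v
    where lemma : ∀ A B u v → + 0 * u + B * (+ 1 * v) ≡ B * v
          lemma = solve-∀

  im-α· : ∀ z → im (αZ · z) ≡ re z + A * im z
  im-α· (u + v α) = lemma A B u v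
    where lemma : ∀ A B u v → + 0 * v + u * + 1 + A * (+ 1 * v) ≡ u + A * v
          lemma = solve-∀

  U≡im-α^ : ∀ n → U A B n ≡ im (powZα A B αZ n)
  U≡im-α^ zero = refl
  U≡im-α^ (suc zero) = sym (trans (im-α· oneZα) (lemma A))
    where lemma : ∀ A → + 1 + A * + 0 ≡ + 1
          lemma = solve-∀
  U≡im-α^ (suc (suc n)) = begin
    A * U A B (suc n) + B * U A B n        ≡⟨ ℤₚ.+-comm (A * U A B (suc n)) _ ⟩
    B * U A B n + A * U A B (suc n)
      ≡⟨ cong₂ (λ u u′ → B * u + A * u′) (U≡im-α^ n) (U≡im-α^ (suc n)) ⟩
    B * im (α^ n) + A * im (α^ (suc n))    ≡⟨ cong (_+ A * im (α^ (suc n))) (re-α· (α^ n)) ⟨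
    re (α^ (suc n)) + A * im (α^ (suc n))  ≡⟨ im-α· (α^ (suc n)) ⟨
    im (α^ (suc (suc n)))                  ∎
    where
      open ≡-Reasoning
      α^ = powZα A B αZ

  module Modulo (m : ℕ) where
    open Modular m

    infix 4 _≈_
    record _≈_ (x y : Zα) : Set where
      constructor mk≈
      field
        re≋ : re x ≋ re y
        im≋ : im x ≋ im y
    open _≈_ public

    ≈⇒≈[mod] : ∀ {x y} → x ≈ y → x ≈ y [modZα m ]
    ≈⇒≈[mod] (mk≈ re≋ im≋) = ≋⇒≡[mod] re≋ , ≋⇒≡[mod] im≋

    ≈[mod]⇒≈ : ∀ {x y} → x ≈ y [modZα m ] → x ≈ y
    ≈[mod]⇒≈ (re≡ , im≡) = mk≈ (mk≋ re≡) (mk≋ im≡)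

    ≈-isEquivalence : IsEquivalence _≈_
    ≈-isEquivalence = record
      { refl = mk≈ ≋-refl ≋-refl
      ; sym = λ (mk≈ r i) → mk≈ (≋-sym r) (≋-sym i)
      ; trans = λ (mk≈ r i) (mk≈ r′ i′) → mk≈ (≋-trans r r′) (≋-trans i i′)
      }

    open IsEquivalence ≈-isEquivalence public using ()
      renaming (refl to ≈-refl; trans to ≈-trans; reflexive to ≈-reflexive)

    +α-cong : ∀ {x x′ y y′} → x ≈ x′ → y ≈ y′ → addZα x y ≈ addZα x′ y′
    +α-cong {_ + _ α} {_ + _ α} {_ + _ α} {_ + _ α} (mk≈ r i) (mk≈ r′ i′) =
      mk≈ (+-cong r r′) (+-cong i i′)

    ·-cong : ∀ {x x′ y y′} → x ≈ x′ → y ≈ y′ → x · y ≈ x′ · y′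
    ·-cong {_ + _ α} {_ + _ α} {_ + _ α} {_ + _ α} (mk≈ r i) (mk≈ r′ i′) =
      mk≈ (+-cong (*-cong r r′) (*-congˡ {B} (*-cong i i′)))
          (+-cong (+-cong (*-cong r i′) (*-cong r′ i)) (*-congˡ {A} (*-cong i i′)))

    ℤ[α]/m : CommutativeSemiring 0ℓ 0ℓ
    ℤ[α]/m = quotientCommutativeSemiring isCommutativeSemiring ≈-isEquivalence +α-cong ·-cong

    open Exp (CommutativeSemiring.semiring ℤ[α]/m) public
      using (_^_; ^-homo-*; ^-assocʳ; ^-congˡ; ^-congʳ)

    powZα≡^ : ∀ x n → powZα A B x n ≡ x ^ n
    powZα≡^ x zero = refl
    powZα≡^ x (suc n) = cong (x ·_) (powZα≡^ x n)

    ι-^ : ∀ x n → ι x ^ n ≡ ι (x ℤ.^ n)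
    ι-^ x zero = refl
    ι-^ x (suc n) = trans (cong (ι x ·_) (ι-^ x n)) (ι-· x (x ℤ.^ n))

    private
      α^ : ℕ → Zα
      α^ = powZα A B αZ

    ≈-setoid : Setoid 0ℓ 0ℓ
    ≈-setoid = CommutativeSemiring.setoid ℤ[α]/m

    conj-≈1⇒≈1 : ∀ z → conj z ≈ oneZα → z ≈ oneZα
    conj-≈1⇒≈1 (u + v α) (mk≈ u+Av≋1 -v≋0) = mk≈ u≋1 v≋0
      where
        v≋0 : v ≋ + 0
        v≋0 = ≋-trans (≋-reflexive (sym (ℤₚ.neg-involutive v))) (neg-cong -v≋0)
        u≋1 : u ≋ + 1
        u≋1 = ≋-trans (≋-reflexive (lemma u v A)) (≋-trans
                (+-cong u+Av≋1 (neg-cong (*-congˡ {A} v≋0))) (≋-reflexive (lemma′ A)))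
          where
            lemma : ∀ u v A → u ≡ (u + A * v) + - (A * v)
            lemma = solve-∀
            lemma′ : ∀ A → + 1 + - (A * + 0) ≡ + 1
            lemma′ = solve-∀

    ≈1⇒conj-≈1 : ∀ z → z ≈ oneZα → conj z ≈ oneZα
    ≈1⇒conj-≈1 (u + v α) (mk≈ u≋1 v≋0) =
      mk≈ (≋-trans (+-cong u≋1 (*-congˡ {A} v≋0)) (≋-reflexive (lemma A))) (neg-cong v≋0)
      where lemma : ∀ A → + 1 + A * + 0 ≡ + 1
            lemma = solve-∀

    α^≈1⇒hasPeriod : ∀ k → α^ k ≈ oneZα → HasPeriod A B m k
    α^≈1⇒hasPeriod k α^k≈1 j =
      ≋⇒≡[mod] (subst₂ _≋_ (sym (U≡im-α^ (j ℕ.+ k))) (sym (U≡im-α^ j)) (im≋ (begin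
      α^ (j ℕ.+ k)        ≡⟨ powZα≡^ αZ (j ℕ.+ k) ⟩
      αZ ^ (j ℕ.+ k)      ≈⟨ ^-homo-* αZ j k ⟩
      αZ ^ j · αZ ^ k     ≡⟨ cong₂ _·_ (powZα≡^ αZ j) (powZα≡^ αZ k) ⟨
      α^ j · α^ k         ≈⟨ ·-cong (≈-refl {α^ j}) α^k≈1 ⟩
      α^ j · oneZα        ≡⟨ ·-identityʳ (α^ j) ⟩
      α^ j                ∎)))
      where open import Relation.Binary.Reasoning.Setoid ≈-setoid

    hasPeriod⇒α^≈1 : ∀ k → HasPeriod A B m k → α^ k ≈ oneZα
    hasPeriod⇒α^≈1 k period = mk≈ re≋1 im≋0
      where
        im≋0 : im (α^ k) ≋ + 0
        im≋0 = subst (_≋ + 0) (U≡im-α^ k) (mk≋ (period 0))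
        re+Aim≋1 : re (α^ k) + A * im (α^ k) ≋ + 1
        re+Aim≋1 = subst (_≋ + 1) (trans (U≡im-α^ (suc k)) (im-α· (α^ k))) (mk≋ (period 1))
        re≋1 : re (α^ k) ≋ + 1
        re≋1 = ≋-trans (≋-reflexive (lemma (re (α^ k)) (im (α^ k)) A)) (≋-trans
                 (+-cong re+Aim≋1 (neg-cong (*-congˡ {A} im≋0))) (≋-reflexive (lemma′ A)))
          where
            lemma : ∀ r i A → r ≡ (r + A * i) + - (A * i)
            lemma = solve-∀
            lemma′ : ∀ A → + 1 + - (A * + 0) ≡ + 1
            lemma′ = solve-∀

    open Mult (CommutativeSemiring.+-monoid ℤ[α]/m) using () renaming (_×_ to _×ₙ_)

    ×ₙ≡ : ∀ n z → n ×ₙ z ≡ (+ n * re z) + (+ n * im z) α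
    ×ₙ≡ zero z = refl
    ×ₙ≡ (suc n) z@(u + v α) rewrite ×ₙ≡ n z =
      Zα-≡ (sym (ℤₚ.suc-* (+ n) u)) (sym (ℤₚ.suc-* (+ n) v))

    ℤ[α]/m-characteristic : Frobenius.CharacteristicDivides ℤ[α]/m m
    ℤ[α]/m-characteristic z rewrite ×ₙ≡ m z = mk≈ (m*≋0 (re z)) (m*≋0 (im z))

    ᾱ^≈1⇔α^≈1 : ∀ k → powZα A B (αbarZ A) k ≈ oneZα ⇔ α^ k ≈ oneZα
    ᾱ^≈1⇔α^≈1 k = mk⇔
      (λ ᾱ^k≈1 → conj-≈1⇒≈1 (α^ k) (subst (_≈ oneZα) (sym (conj-α^ k)) ᾱ^k≈1))
      (λ α^k≈1 → subst (_≈ oneZα) (conj-α^ k) (≈1⇒conj-≈1 (α^ k) α^k≈1))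

    ≈1? : ∀ z → Dec (z ≈ oneZα)
    ≈1? z = map′ (λ (r , i) → mk≈ r i) (λ (mk≈ r i) → r , i)
                 ((re z ≋? + 1) ×-dec (im z ≋? + 0))

    order-exists : ∀ {N} → 0 < N → α^ N ≈ oneZα →
      ∃ λ n → IsOrd A B m αZ n × IsOrd A B m (αbarZ A) n × IsPi A B m n
    order-exists 0<N α^N≈1 with least-positive (λ k → ≈1? (α^ k)) 0<N α^N≈1
    ... | n , 0<n , α^n≈1 , minimal =
      n , (0<n , ≈⇒≈[mod] α^n≈1 , λ k 0<k k<n → minimal k 0<k k<n ∘ ≈[mod]⇒≈)
        , (0<n , ≈⇒≈[mod] (Equivalence.from (ᾱ^≈1⇔α^≈1 n) α^n≈1)
               , λ k 0<k k<n → minimal k 0<k k<n ∘ Equivalence.to (ᾱ^≈1⇔α^≈1 k) ∘ ≈[mod]⇒≈)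
        , (0<n , α^≈1⇒hasPeriod n α^n≈1
               , λ k 0<k k<n → minimal k 0<k k<n ∘ hasPeriod⇒α^≈1 k)

  module _ {m : ℕ} where
    open Modulo (m ℕ.* m)
    open Modular (m ℕ.* m)

    ∣∧∣⇒*≋0 : ∀ x y → + m ∣ x → + m ∣ y → x * y ≋ + 0
    ∣∧∣⇒*≋0 x y m∣x m∣y =
      ∣⇒≋0 (subst (m ℕ.* m ℕ.∣_) (sym (ℤₚ.abs-* x y)) (ℕ.*-pres-∣ m∣x m∣y))

    -- Every term of the expansion that is quadratic in u and v vanishes modulo m².
    [1+u+vα]^n≈[1+nu]+nvα : ∀ {u v} → + m ∣ u → + m ∣ v →
      ∀ n → powZα A B ((+ 1 + u) + v α) n ≈ (+ 1 + + n * u) + (+ n * v) α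
    [1+u+vα]^n≈[1+nu]+nvα {u} {v} _ _ zero = ≈-reflexive (Zα-≡ (lemma₁ u) (lemma₂ v))
      where
        lemma₁ : ∀ u → + 1 ≡ + 1 + + 0 * u
        lemma₁ = solve-∀
        lemma₂ : ∀ v → + 0 ≡ + 0 * v
        lemma₂ = solve-∀
    [1+u+vα]^n≈[1+nu]+nvα {u} {v} m∣u m∣v (suc n) =
      ≈-trans (·-cong (≈-refl {(+ 1 + u) + v α}) ([1+u+vα]^n≈[1+nu]+nvα m∣u m∣v n)) (mk≈
        (-≋0⇒≋ (subst (_≋ + 0) (re-difference A B u v (+ n)) (n*≋0 (≋-trans
          (+-cong uu≋0 (*-congˡ {B} vv≋0)) (≋-reflexive (lemma₁ B))))))
        (-≋0⇒≋ (subst (_≋ + 0) (im-difference A B u v (+ n)) (n*≋0 (≋-trans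
          (+-cong (+-cong uv≋0 uv≋0) (*-congˡ {A} vv≋0)) (≋-reflexive (lemma₂ A)))))))
      where
        uu≋0 = ∣∧∣⇒*≋0 u u m∣u m∣u
        uv≋0 = ∣∧∣⇒*≋0 u v m∣u m∣v
        vv≋0 = ∣∧∣⇒*≋0 v v m∣v m∣v
        n*≋0 : ∀ {x} → x ≋ + 0 → + n * x ≋ + 0
        n*≋0 x≋0 = ≋-trans (*-congˡ {+ n} x≋0) (≋-reflexive (ℤₚ.*-zeroʳ (+ n)))
        re-difference : ∀ A B u v N → N * (u * u + B * (v * v))
          ≡ (+ 1 + u) * (+ 1 + N * u) + B * (v * (N * v)) - (+ 1 + (+ 1 + N) * u)
        re-difference = solve-∀
        im-difference : ∀ A B u v N → N * (u * v + u * v + A * (v * v))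
          ≡ (+ 1 + u) * (N * v) + (+ 1 + N * u) * v + A * (v * (N * v)) - (+ 1 + N) * v
        im-difference = solve-∀
        lemma₁ : ∀ B → + 0 + B * + 0 ≡ + 0
        lemma₁ = solve-∀
        lemma₂ : ∀ A → + 0 + + 0 + A * + 0 ≡ + 0
        lemma₂ = solve-∀

  ≈1⇒^m≈1 : ∀ {m} z → Modulo._≈_ m z oneZα → Modulo._≈_ (m ℕ.* m) (powZα A B z m) oneZα
  ≈1⇒^m≈1 {m} (r + v α) z≈1 = begin
    powZα A B (r + v α) m              ≡⟨ cong (λ w → powZα A B w m) (Zα-≡ (lemma r) refl) ⟩
    powZα A B ((+ 1 + u) + v α) m      ≈⟨ [1+u+vα]^n≈[1+nu]+nvα {m} m∣u m∣v m ⟩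
    (+ 1 + + m * u) + (+ m * v) α      ≈⟨ mk≈ 1+mu≋1 (m*≋0 v m∣v) ⟩
    oneZα                              ∎
    where
      open Modulo (m ℕ.* m)
      open Modular (m ℕ.* m) hiding (m*≋0)
      open import Relation.Binary.Reasoning.Setoid ≈-setoid
      lemma : ∀ r → r ≡ + 1 + (r - + 1)
      lemma = solve-∀
      u = r - + 1
      m∣u : + m ∣ u
      m∣u = Modular.≋⇒≡[mod] (Modulo.re≋ z≈1)
      m∣v : + m ∣ v
      m∣v = subst (λ w → + m ∣ w) (ℤₚ.+-identityʳ v) (Modular.≋⇒≡[mod] (Modulo.im≋ z≈1))
      m*≋0 : ∀ x → + m ∣ x → + m * x ≋ + 0
      m*≋0 x = ∣∧∣⇒*≋0 {m} (+ m) x (ℕ.∣-refl {m})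
      1+mu≋1 : + 1 + + m * u ≋ + 1
      1+mu≋1 = ≋-trans (+-cong (≋-refl {+ 1}) (m*≋0 u m∣u)) (≋-reflexive (ℤₚ.+-identityʳ (+ 1)))

  α^≈1⇒α^[N*m]≈1 : ∀ {m} N → Modulo._≈_ m (powZα A B αZ N) oneZα →
    Modulo._≈_ (m ℕ.* m) (powZα A B αZ (N ℕ.* m)) oneZα
  α^≈1⇒α^[N*m]≈1 {m} N α^N≈1 = begin
    powZα A B αZ (N ℕ.* m)                ≡⟨ powZα≡^ αZ (N ℕ.* m) ⟩
    αZ ^ (N ℕ.* m)                        ≈⟨ ^-assocʳ αZ N m ⟨
    (αZ ^ N) ^ m                          ≡⟨ trans (powZα≡^ _ m) (cong (_^ m) (powZα≡^ αZ N)) ⟨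
    powZα A B (powZα A B αZ N) m          ≈⟨ ≈1⇒^m≈1 _ α^N≈1 ⟩
    oneZα                                 ∎
    where
      open Modulo (m ℕ.* m)
      open import Relation.Binary.Reasoning.Setoid ≈-setoid

-- The Frobenius map on ℤ[α]/p

module FrobeniusOnα (a b : ℕ) {p} (p-prime : Prime p) (2<p : 2 < p)
  (nonresidue : LegendreMinusOne (+ (a ℕ.* a ℕ.+ 4 ℕ.* b)) p) where
  open import Data.Integer using (_+_; _*_; -_)

  open PrimeModulus p-prime
  open QuadraticRing (+ a) (+ b)
  open Modulo p

  Δ : ℕ
  Δ = a ℕ.* a ℕ.+ 4 ℕ.* b

  β : Zα
  β = (- + a) + (+ 2) α

  β·β≡Δ : β · β ≡ ι (+ Δ)
  β·β≡Δ = Zα-≡ (trans (lemma₁ (+ a) (+ b)) (sym +Δ≡)) (lemma₂ (+ a) (+ b))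
    where
      +Δ≡ : + Δ ≡ + a * + a + + 4 * + b
      +Δ≡ = trans (ℤₚ.pos-+ (a ℕ.* a) (4 ℕ.* b)) (cong₂ _+_ (ℤₚ.pos-* a a) (ℤₚ.pos-* 4 b))
      lemma₁ : ∀ A B → - A * - A + B * (+ 2 * + 2) ≡ A * A + + 4 * B
      lemma₁ = solve-∀
      lemma₂ : ∀ A B → - A * + 2 + - A * + 2 + A * (+ 2 * + 2) ≡ + 0
      lemma₂ = solve-∀

  private
    euler = euler-criterion 2<p Δ nonresidue
    k = proj₁ euler
    p≡1+2k : p ≡ suc (k ℕ.+ k)
    p≡1+2k = proj₁ (proj₂ euler)
    Δ^k≋-1 : (+ Δ) ℤ.^ k ≋ - + 1
    Δ^k≋-1 = proj₂ (proj₂ euler)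

  β^p≈-β : β ^ p ≈ (+ a) + (- + 2) α
  β^p≈-β = begin
    β ^ p                       ≈⟨ ^-congʳ β p≡1+2k ⟩
    β · β ^ (k ℕ.+ k)           ≈⟨ β·_ (^-congʳ β (cong (k ℕ.+_) (sym (ℕₚ.+-identityʳ k)))) ⟩
    β · β ^ (2 ℕ.* k)           ≈⟨ β·_ (^-assocʳ β 2 k) ⟨
    β · (β ^ 2) ^ k             ≡⟨ cong (λ z → β · z ^ k) (trans (cong (β ·_) (·-identityʳ β)) β·β≡Δ) ⟩
    β · ι (+ Δ) ^ k             ≡⟨ cong (β ·_) (ι-^ (+ Δ) k) ⟩
    β · ι ((+ Δ) ℤ.^ k)         ≈⟨ β·_ (mk≈ Δ^k≋-1 ≋-refl) ⟩
    β · ι (- + 1)               ≡⟨ Zα-≡ (lemma₁ (+ a) (+ b)) (lemma₂ (+ a) (+ b)) ⟩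
    (+ a) + (- + 2) α           ∎
    where
      open import Relation.Binary.Reasoning.Setoid ≈-setoid
      β·_ : ∀ {z w} → z ≈ w → β · z ≈ β · w
      β·_ = ·-cong (≈-refl {β})
      lemma₁ : ∀ A B → - A * - + 1 + B * (+ 2 * + 0) ≡ A
      lemma₁ = solve-∀
      lemma₂ : ∀ A B → - A * + 0 + - + 1 * + 2 + A * (+ 2 * + 0) ≡ - + 2
      lemma₂ = solve-∀

  fermat-ι : ∀ n → ι (+ n) ^ p ≈ ι (+ n)
  fermat-ι n = ≈-trans (≈-reflexive (ι-^ (+ n) p)) (mk≈ (fermat n) ≋-refl)

  ι-·-cancel : ∀ {c} z w → c ≉ + 0 → ι c · z ≈ ι c · w → z ≈ w
  ι-·-cancel {c} (u + v α) (u′ + v′ α) c≉0 (mk≈ re≋ im≋) =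
    mk≈ (*-cancelˡ-≋ c c≉0 (subst₂ _≋_ (lemma₁ (+ b) c u v) (lemma₁ (+ b) c u′ v′) re≋))
        (*-cancelˡ-≋ c c≉0 (subst₂ _≋_ (lemma₂ (+ a) c u v) (lemma₂ (+ a) c u′ v′) im≋))
    where
      lemma₁ : ∀ B c u v → c * u + B * (+ 0 * v) ≡ c * u
      lemma₁ = solve-∀
      lemma₂ : ∀ A c u v → c * v + u * + 0 + A * (+ 0 * v) ≡ c * v
      lemma₂ = solve-∀

  α^p≈ᾱ : αZ ^ p ≈ αbarZ (+ a)
  α^p≈ᾱ = ι-·-cancel (αZ ^ p) (αbarZ (+ a)) (<p⇒≉0 (s≤s z≤n) 2<p) (begin
    ι (+ 2) · αZ ^ p                 ≈⟨ ·-cong (fermat-ι 2) (≈-refl {αZ ^ p}) ⟨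
    ι (+ 2) ^ p · αZ ^ p             ≈⟨ ^-distrib-* (ι (+ 2)) αZ p ⟨
    (ι (+ 2) · αZ) ^ p               ≡⟨ cong (_^ p) 2α≡a+β ⟩
    addZα (ι (+ a)) β ^ p            ≈⟨ frobenius (ι (+ a)) β ⟩
    addZα (ι (+ a) ^ p) (β ^ p)      ≈⟨ +α-cong (fermat-ι a) β^p≈-β ⟩
    addZα (ι (+ a)) ((+ a) + (- + 2) α) ≡⟨ Zα-≡ (lemma₁ (+ a) (+ b)) (lemma₂ (+ a)) ⟩
    ι (+ 2) · αbarZ (+ a)            ∎)
    where
      open import Relation.Binary.Reasoning.Setoid ≈-setoid
      open CExp ℤ[α]/m using (^-distrib-*)
      frobenius = Frobenius.^-distrib-+ ℤ[α]/m p-prime ℤ[α]/m-characteristic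
      2α≡a+β : ι (+ 2) · αZ ≡ addZα (ι (+ a)) β
      2α≡a+β = Zα-≡ (lemma₃ (+ a) (+ b)) (lemma₄ (+ a))
        where
          lemma₃ : ∀ A B → + 2 * + 0 + B * (+ 0 * + 1) ≡ A + - A
          lemma₃ = solve-∀
          lemma₄ : ∀ A → + 2 * + 1 + + 0 * + 0 + A * (+ 0 * + 1) ≡ + 0 + + 2
          lemma₄ = solve-∀
      lemma₁ : ∀ A B → A + A ≡ + 2 * A + B * (+ 0 * - + 1)
      lemma₁ = solve-∀
      lemma₂ : ∀ A → + 0 + - + 2 ≡ + 2 * - + 1 + A * + 0 + A * (+ 0 * - + 1)
      lemma₂ = solve-∀

  α^[p+1]≈-b : αZ ^ suc p ≈ ι (- + b)
  α^[p+1]≈-b = begin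
    αZ · αZ ^ p          ≈⟨ ·-cong (≈-refl {αZ}) α^p≈ᾱ ⟩
    αZ · αbarZ (+ a)     ≡⟨ Zα-≡ (lemma₁ (+ a) (+ b)) (lemma₂ (+ a) (+ b)) ⟩
    ι (- + b)            ∎
    where
      open import Relation.Binary.Reasoning.Setoid ≈-setoid
      lemma₁ : ∀ A B → + 0 * A + B * (+ 1 * - + 1) ≡ - B
      lemma₁ = solve-∀
      lemma₂ : ∀ A B → + 0 * - + 1 + A * + 1 + A * (+ 1 * - + 1) ≡ + 0
      lemma₂ = solve-∀

  b≉0 : + b ≉ + 0
  b≉0 b≋0 = nonresidue (+ a , ≋⇒≡[mod] (begin
    + a * + a                   ≡⟨ ℤₚ.+-identityʳ (+ a * + a) ⟨
    + a * + a + + 0             ≈⟨ +-cong (≋-refl {+ a * + a}) (*-congˡ {+ 4} b≋0) ⟨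
    + a * + a + + 4 * + b       ≡⟨ cong₂ _+_ (ℤₚ.pos-* a a) (ℤₚ.pos-* 4 b) ⟨
    + (a ℕ.* a) + + (4 ℕ.* b)   ≡⟨ ℤₚ.pos-+ (a ℕ.* a) (4 ℕ.* b) ⟨
    + Δ                         ∎))
    where open import Relation.Binary.Reasoning.Setoid ≋-setoid

  N : ℕ
  N = suc p ℕ.* 2 ℕ.* (p ∸ 1)

  0<N : 0 < N
  0<N = ℕₚ.*-mono-< (ℕₚ.*-mono-< {0} {suc p} {0} {2} (s≤s z≤n) (s≤s z≤n)) (ℕₚ.m<n⇒0<n∸m 1<p)

  α^N≈1 : αZ ^ N ≈ oneZα
  α^N≈1 = begin
    αZ ^ (suc p ℕ.* 2 ℕ.* (p ∸ 1))        ≈⟨ ^-assocʳ αZ (suc p ℕ.* 2) (p ∸ 1) ⟨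
    (αZ ^ (suc p ℕ.* 2)) ^ (p ∸ 1)        ≈⟨ ^-congˡ (p ∸ 1) (^-assocʳ αZ (suc p) 2) ⟨
    ((αZ ^ suc p) ^ 2) ^ (p ∸ 1)          ≈⟨ ^-congˡ (p ∸ 1) (^-congˡ 2 α^[p+1]≈-b) ⟩
    (ι (- + b) ^ 2) ^ (p ∸ 1)             ≡⟨ trans (cong (_^ (p ∸ 1)) (ι-^ (- + b) 2)) (ι-^ _ (p ∸ 1)) ⟩
    ι (((- + b) ℤ.^ 2) ℤ.^ (p ∸ 1))
      ≡⟨ cong (λ x → ι (x ℤ.^ (p ∸ 1))) (trans (square (+ b)) (sym (ℤₚ.pos-* b b))) ⟩
    ι ((+ (b ℕ.* b)) ℤ.^ (p ∸ 1))         ≈⟨ mk≈ (fermat-unit (b ℕ.* b) b²≉0) ≋-refl ⟩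
    oneZα                                 ∎
    where
      open import Relation.Binary.Reasoning.Setoid ≈-setoid
      square : ∀ x → (- x) ℤ.^ 2 ≡ x * x
      square x = lemma x
        where lemma : ∀ x → - x * (- x * + 1) ≡ x * x
              lemma = solve-∀
      b²≉0 : + (b ℕ.* b) ≉ + 0
      b²≉0 b²≋0 with *-≋0 (+ b) (+ b) (subst (_≋ + 0) (ℤₚ.pos-* b b) b²≋0)
      ... | inj₁ b≋0 = b≉0 b≋0
      ... | inj₂ b≋0 = b≉0 b≋0

open import Data.Nat using (_*_)
open import Data.Nat.Divisibility using (_∣_)
open import Data.Integer using (-_)

Δ≡calD⊎Δ≡4calD : ∀ a b → a * a ℕ.+ 4 * b ≡ calD a b ⊎ a * a ℕ.+ 4 * b ≡ 2 * 2 * calD a b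
Δ≡calD⊎Δ≡4calD a b with a % 2 in a%2
... | suc _ = inj₁ refl
... | 0 = inj₂ (trans (cong (λ x → x * x ℕ.+ 4 * b) a≡2h) (lemma (a / 2) b))
  where
    a≡2h : a ≡ (a / 2) * 2
    a≡2h = trans (m≡m%n+[m/n]*n a 2) (cong (ℕ._+ (a / 2) * 2) a%2)
    lemma : ∀ h b → h * 2 * (h * 2) ℕ.+ 4 * b ≡ 2 * 2 * (h * h ℕ.+ b)
    lemma = ℕ.solve-∀

module _ {p} (p-prime : Prime p) (2<p : 2 < p) where
  open PrimeModulus p-prime

  calD-nonresidue⇒Δ-nonresidue : ∀ a b → LegendreMinusOne (+ calD a b) p →
    LegendreMinusOne (+ (a * a ℕ.+ 4 * b)) p
  calD-nonresidue⇒Δ-nonresidue a b nonresidue with Δ≡calD⊎Δ≡4calD a b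
  ... | inj₁ Δ≡calD = subst (λ D → LegendreMinusOne (+ D) p) (sym Δ≡calD) nonresidue
  ... | inj₂ Δ≡4calD = subst (λ D → LegendreMinusOne D p)
          (sym (trans (cong +_ Δ≡4calD)
            (trans (ℤₚ.pos-* (2 * 2) (calD a b)) (cong (ℤ._* + calD a b) (ℤₚ.pos-* 2 2)))))
          (nonresidue-*-square 2 (<p⇒≉0 (s≤s z≤n) 2<p) nonresidue)

lemma3p4 : (a b : ℕ) → 0 < a → 0 < b → ¬ (4 ∣ a) → SquareFree b →
    SquareFree (calD a b) → (p : ℕ) → Prime p → 3 ≤ p →
    LegendreMinusOne (+ (calD a b)) p →
    ((m : ℕ) → (m ≡ p ⊎ m ≡ p * p) →
      ∃ λ n → IsOrd (+ a) (+ b) m αZ n × IsOrd (+ a) (+ b) m (αbarZ (+ a)) n × IsPi (+ a) (+ b) m n)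
    × (powZα (+ a) (+ b) αZ (suc p) ≈ (- (+ b)) + (+ 0) α [modZα p ])
lemma3p4 a b _ _ _ _ _ p p-prime 2<p nonresidue = orders , ≈⇒≈[mod] (α^≈ (suc p) α^[p+1]≈-b)
  where
    open FrobeniusOnα a b p-prime 2<p (calD-nonresidue⇒Δ-nonresidue p-prime 2<p a b nonresidue)
    open QuadraticRing (+ a) (+ b)
    open Modulo p
    α^≈ : ∀ n {z} → αZ ^ n ≈ z → powZα (+ a) (+ b) αZ n ≈ z
    α^≈ n = ≈-trans (≈-reflexive (powZα≡^ αZ n))
    orders : (m : ℕ) → m ≡ p ⊎ m ≡ p * p →
      ∃ λ n → IsOrd (+ a) (+ b) m αZ n × IsOrd (+ a) (+ b) m (αbarZ (+ a)) n × IsPi (+ a) (+ b) m n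
    orders m (inj₁ refl) = order-exists 0<N (α^≈ N α^N≈1)
    orders m (inj₂ refl) = Modulo.order-exists (p * p) (ℕₚ.*-mono-< 0<N (ℕₚ.<-trans (s≤s z≤n) 2<p))
                             (α^≈1⇒α^[N*m]≈1 N (α^≈ N α^N≈1))
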